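{- Let $\mathbf I=(I,\rightarrow,0)$ be an effect implication algebra and define, for $x,y\in I$, $x':=x\rightarrow0$, $1:=0'$, and the partial operation $+$ by: $x+y$ is defined if and only if $x\rightarrow y'=1$, and in this case $x+y:=x'\rightarrow y$. Then $(I,+,{}',0,1)$ is an effect algebra satisfying the Ascending Chain Condition, whose induced order $\leq$ is given by $x\leq y$ if and only if $x\rightarrow y=1$.
   Context: An effect algebra is a structure $(E,+,{}',0,1)$ where $E$ is a set, ${}'$ is a unary operation on $E$, $0,1\in E$, and $+$ is a partial binary operation on $E$ such that for all $x,y,z\in E$: (E1) if $x+y$ is defined then so is $y+x$ and $x+y=y+x$; (E2) $(x+y)+z$ is defined if and only if $x+(y+z)$ is defined, and then they are equal; (E3) $x+y$ is defined and equals $1$ if and only if $y=x'$; (E4) if $1+x$ is defined then $x=0$. The induced order is $x\leq y$ iff there exists $z$ with $x+z=y$. The Ascending Chain Condition means there is no infinite strictly ascending chain in the induced order. An effect implication algebra is an algebra $(I,\rightarrow,0)$ with a binary operation $\rightarrow$ and a constant $0$ such that, writing $x':=x\rightarrow0$ and $1:=0'$, for all $x,y,z\in I$: (i) $0\rightarrow x=x\rightarrow x=x\rightarrow1=1$; (ii) if $x\rightarrow y=y\rightarrow x=1$ then $x=y$; (iii) if $x\rightarrow y=y\rightarrow z=1$ then $x\rightarrow z=1$; (iv) if $x\rightarrow y=1$ then $y'\rightarrow x'=1$; (v) $x''=x$; (vi) if $x\rightarrow y=1$ then $y\rightarrow x=x'\rightarrow y'$; (vii) [$x\rightarrow y'=1$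 and $(x'\rightarrow y)\rightarrow z'=1$] if and only if [$y\rightarrow z'=1$ and $x\rightarrow(y'\rightarrow z)'=1$], and in this case $(x'\rightarrow y)'\rightarrow z=x'\rightarrow(y'\rightarrow z)$; (viii) $x\rightarrow(y\rightarrow x)=1$; and there is no infinite sequence $a_1,a_2,a_3,\ldots$ of pairwise distinct elements of $I$ with $a_n\rightarrow a_{n+1}=1$ for all positive integers $n$. -}

module Defs where

open import Level using (Level; _⊔_; suc)
open import Data.Nat using (ℕ) renaming (suc to sucℕ)
open import Data.Product using (Σ; ∃; _×_; _,_)
open import Relation.Binary.PropositionalEquality using (_≡_; _≢_)
open import Relation.Nullary using (¬_)

private variable a : Level

-- Effect algebras.  The partial binary operation + is represented by its graph
-- Plus x y z  ("x + y is defined and equals z"), required to be functional.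
module EffectAlgebraNotions {E : Set a} (Plus : E → E → E → Set a) where

  Defined : E → E → Set a
  Defined x y = ∃ λ z → Plus x y z

  _≤E_ : E → E → Set a
  x ≤E y = ∃ λ z → Plus x z y

  _<E_ : E → E → Set a
  x <E y = (x ≤E y) × (x ≢ y)

  AscendingChainCondition : Set a
  AscendingChainCondition = ¬ (Σ (ℕ → E) λ c → ∀ n → c n <E c (sucℕ n))

record IsEffectAlgebra {E : Set a} (Plus : E → E → E → Set a)
                       (_′ : E → E) (𝟘 𝟙 : E) : Set a where
  open EffectAlgebraNotions Plus
  field
    functional : ∀ {x y z w} → Plus x y z → Plus x y w → z ≡ w
    E1 : ∀ {x y z} → Plus x y z → Plus y x z
    E2→ : ∀ {x y z xy s} → Plus x y xy → Plus xy z s →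
          ∃ λ yz → Plus y z yz × Plus x yz s
    E2← : ∀ {x y z yz s} → Plus y z yz → Plus x yz s →
          ∃ λ xy → Plus x y xy × Plus xy z s
    E3→ : ∀ {x y} → Plus x y 𝟙 → y ≡ x ′
    E3← : ∀ {x y} → y ≡ x ′ → Plus x y 𝟙
    E4 : ∀ {x} → Defined 𝟙 x → x ≡ 𝟘

record IsEffectImplicationAlgebra {I : Set a} (_⇒_ : I → I → I) (𝟘 : I) : Set a where
  _′ : I → I
  x ′ = x ⇒ 𝟘
  𝟙 : I
  𝟙 = 𝟘 ′
  field
    i-0 : ∀ x → 𝟘 ⇒ x ≡ 𝟙
    i-refl : ∀ x → x ⇒ x ≡ 𝟙
    i-1 : ∀ x → x ⇒ 𝟙 ≡ 𝟙
    ii : ∀ {x y} → x ⇒ y ≡ 𝟙 → y ⇒ x ≡ 𝟙 → x ≡ y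
    iii : ∀ {x y z} → x ⇒ y ≡ 𝟙 → y ⇒ z ≡ 𝟙 → x ⇒ z ≡ 𝟙
    iv : ∀ {x y} → x ⇒ y ≡ 𝟙 → (y ′) ⇒ (x ′) ≡ 𝟙
    v : ∀ x → (x ′) ′ ≡ x
    vi : ∀ {x y} → x ⇒ y ≡ 𝟙 → y ⇒ x ≡ (x ′) ⇒ (y ′)
    vii→ : ∀ {x y z} → x ⇒ (y ′) ≡ 𝟙 → ((x ′) ⇒ y) ⇒ (z ′) ≡ 𝟙 →
           (y ⇒ (z ′) ≡ 𝟙) × (x ⇒ (((y ′) ⇒ z) ′) ≡ 𝟙)
    vii← : ∀ {x y z} → y ⇒ (z ′) ≡ 𝟙 → x ⇒ (((y ′) ⇒ z) ′) ≡ 𝟙 →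
           (x ⇒ (y ′) ≡ 𝟙) × (((x ′) ⇒ y) ⇒ (z ′) ≡ 𝟙)
    vii-eq : ∀ {x y z} → x ⇒ (y ′) ≡ 𝟙 → ((x ′) ⇒ y) ⇒ (z ′) ≡ 𝟙 →
             (((x ′) ⇒ y) ′) ⇒ z ≡ (x ′) ⇒ ((y ′) ⇒ z)
    viii : ∀ x y → x ⇒ (y ⇒ x) ≡ 𝟙
    no-chain : ¬ (Σ (ℕ → I) λ s →
                   (∀ m n → m ≢ n → s m ≢ s n) × (∀ n → s n ⇒ s (sucℕ n) ≡ 𝟙))

module _ {I : Set a} (_⇒_ : I → I → I) (𝟘 : I) where
  neg : I → I
  neg x = x ⇒ 𝟘
  one : I
  one = neg 𝟘
  PlusEIA : I → I → I → Set a
  PlusEIA x y z = (x ⇒ neg y ≡ one) × (z ≡ neg x ⇒ y)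

-- The translation x + y := x′ → y (defined iff x → y′ = 1) turns the axioms of an
-- effect implication algebra into those of an effect algebra one by one: (iv)–(vi)
-- give commutativity, (vii) is exactly associativity, and (ii) with (i) gives (E3)
-- and (E4).  For the order, x + z = x′ → z ≥ x by (viii); conversely, if x → y = 1
-- then z := (x + y′)′ satisfies y′ + (x + z) = (y′ + x) + z = 1, so x + z = y.
-- Since → = 1 is then a partial order, a strictly ascending chain consists of
-- pairwise distinct elements, which the chain condition of the algebra forbids.
module Submission where

open import Defs
open import Level using (Level)
open import Data.Nat using (ℕ; zero; suc; _+_; _<_)
open import Data.Nat.Properties using (+-suc; +-identityʳ; <-cmp; m≤n⇒∃[o]m+o≡n)
open import Data.Product using (_×_; _,_; ∃; proj₁; proj₂)
open import Relation.Binary.Core using (Rel)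
open import Relation.Binary.Definitions using (tri<; tri≈; tri>)
open import Relation.Binary.Structures using (IsPartialOrder)
open import Relation.Binary.PropositionalEquality
  using (_≡_; _≢_; refl; sym; trans; cong; subst; ≢-sym; isEquivalence)

module AscendingSequence {a ℓ : Level} {A : Set a} {_≼_ : Rel A ℓ}
                         (isPartialOrder : IsPartialOrder _≡_ _≼_)
                         (c : ℕ → A) (step : ∀ n → c n ≼ c (suc n)) where
  open IsPartialOrder isPartialOrder using (antisym) renaming (refl to ≼-refl; trans to ≼-trans)

  monotone : ∀ m k → c m ≼ c (m + k)
  monotone m zero    = subst (λ n → c m ≼ c n) (sym (+-identityʳ m)) ≼-refl
  monotone m (suc k) = subst (λ n → c m ≼ c n) (sym (+-suc m k))
                             (≼-trans (monotone m k) (step (m + k)))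

  strict⇒<⇒≢ : (∀ n → c n ≢ c (suc n)) → ∀ {m n} → m < n → c m ≢ c n
  strict⇒<⇒≢ strict {m} m<n cm≡cn with m≤n⇒∃[o]m+o≡n m<n
  ... | k , refl = strict m (antisym (step m)
                             (subst (c (suc m) ≼_) (sym cm≡cn) (monotone (suc m) k)))

  strict⇒injective : (∀ n → c n ≢ c (suc n)) → ∀ m n → m ≢ n → c m ≢ c n
  strict⇒injective strict m n m≢n with <-cmp m n
  ... | tri< m<n _ _ = strict⇒<⇒≢ strict m<n
  ... | tri≈ _ m≡n _ = λ _ → m≢n m≡n
  ... | tri> _ _ n<m = ≢-sym (strict⇒<⇒≢ strict n<m)

module EffectImplicationAlgebraProperties {a : Level} {I : Set a} (_⇒_ : I → I → I) (𝟘 : I)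
                                          (isEIA : IsEffectImplicationAlgebra _⇒_ 𝟘) where
  open IsEffectImplicationAlgebra isEIA

  infix 4 _≤_
  _≤_ : I → I → Set a
  x ≤ y = x ⇒ y ≡ 𝟙

  ≤-isPartialOrder : IsPartialOrder _≡_ _≤_
  ≤-isPartialOrder = record
    { isPreorder = record
      { isEquivalence = isEquivalence
      ; reflexive     = λ { {x} refl → i-refl x }
      ; trans         = iii
      }
    ; antisym = ii
    }

  ≤-′′ʳ : ∀ {x y} → x ≤ y → x ≤ (y ′) ′
  ≤-′′ʳ {x} {y} = subst (x ≤_) (sym (v y))

  ≤′-sym : ∀ {x y} → x ≤ y ′ → y ≤ x ′
  ≤′-sym {x} {y} x≤y′ = subst (_≤ x ′) (v y) (iv x≤y′)

  ′⇒-comm : ∀ {x y} → x ≤ y ′ → (x ′) ⇒ y ≡ (y ′) ⇒ x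
  ′⇒-comm {x} {y} x≤y′ = trans (cong ((x ′) ⇒_) (sym (v y))) (sym (vi x≤y′))

module InducedEffectAlgebra {a : Level} {I : Set a} (_⇒_ : I → I → I) (𝟘 : I)
                            (isEIA : IsEffectImplicationAlgebra _⇒_ 𝟘) where
  open IsEffectImplicationAlgebra isEIA
  open EffectImplicationAlgebraProperties _⇒_ 𝟘 isEIA

  Plus : I → I → I → Set a
  Plus = PlusEIA _⇒_ 𝟘

  open EffectAlgebraNotions Plus

  functional : ∀ {x y z w} → Plus x y z → Plus x y w → z ≡ w
  functional (_ , z≡) (_ , w≡) = trans z≡ (sym w≡)

  comm : ∀ {x y z} → Plus x y z → Plus y x z
  comm (x≤y′ , z≡) = ≤′-sym x≤y′ , trans z≡ (′⇒-comm x≤y′)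

  assoc→ : ∀ {x y z xy s} → Plus x y xy → Plus xy z s → ∃ λ yz → Plus y z yz × Plus x yz s
  assoc→ {y = y} {z} (x≤y′ , refl) (xy≤z′ , refl) =
    let y≤z′ , x≤yz′ = vii→ x≤y′ xy≤z′
    in (y ′) ⇒ z , (y≤z′ , refl) , (x≤yz′ , vii-eq x≤y′ xy≤z′)

  assoc← : ∀ {x y z yz s} → Plus y z yz → Plus x yz s → ∃ λ xy → Plus x y xy × Plus xy z s
  assoc← {x} {y} (y≤z′ , refl) (x≤yz′ , refl) =
    let x≤y′ , xy≤z′ = vii← y≤z′ x≤yz′
    in (x ′) ⇒ y , (x≤y′ , refl) , (xy≤z′ , sym (vii-eq x≤y′ xy≤z′))

  sum≡𝟙⇒≡′ : ∀ {x y} → Plus x y 𝟙 → y ≡ x ′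
  sum≡𝟙⇒≡′ (x≤y′ , 𝟙≡) = ii (≤′-sym x≤y′) (sym 𝟙≡)

  ≡′⇒sum≡𝟙 : ∀ {x y} → y ≡ x ′ → Plus x y 𝟙
  ≡′⇒sum≡𝟙 {x} refl = ≤-′′ʳ (i-refl x) , sym (i-refl (x ′))

  𝟙-summand⇒𝟘 : ∀ {x} → Defined 𝟙 x → x ≡ 𝟘
  𝟙-summand⇒𝟘 {x} (_ , 𝟙≤x′ , _) = ii (subst (x ≤_) (v 𝟘) (≤′-sym 𝟙≤x′)) (i-0 x)

  isEffectAlgebra : IsEffectAlgebra Plus _′ 𝟘 𝟙
  isEffectAlgebra = record
    { functional = functional
    ; E1         = comm
    ; E2→        = assoc→
    ; E2←        = assoc←
    ; E3→        = sum≡𝟙⇒≡′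
    ; E3←        = ≡′⇒sum≡𝟙
    ; E4         = 𝟙-summand⇒𝟘
    }

  ≤E⇒≤ : ∀ {x y} → x ≤E y → x ≤ y
  ≤E⇒≤ {x} (z , x≤z′ , refl) = subst (x ≤_) (sym (′⇒-comm x≤z′)) (viii x (z ′))

  ≤⇒≤E : ∀ {x y} → x ≤ y → x ≤E y
  ≤⇒≤E {x} {y} x≤y with assoc→ (comm (≤-′′ʳ x≤y , refl)) (≡′⇒sum≡𝟙 refl)
  ... | x+z , (x≤z′ , x+z≡) , y′+[x+z]≡𝟙 =
    _ , x≤z′ , trans (sym (trans (sum≡𝟙⇒≡′ y′+[x+z]≡𝟙) (v y))) x+z≡

  ascendingChainCondition : AscendingChainCondition
  ascendingChainCondition (c , ascending) =
    no-chain (c , strict⇒injective (λ n → proj₂ (ascending n)) , step)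
    where
      step : ∀ n → c n ≤ c (suc n)
      step n = ≤E⇒≤ (proj₁ (ascending n))
      open AscendingSequence ≤-isPartialOrder c step

theorem5p4 : {a : Level} {I : Set a} (_⇒_ : I → I → I) (𝟘 : I) →
    IsEffectImplicationAlgebra _⇒_ 𝟘 →
    IsEffectAlgebra (PlusEIA _⇒_ 𝟘) (neg _⇒_ 𝟘) 𝟘 (one _⇒_ 𝟘)
    × EffectAlgebraNotions.AscendingChainCondition (PlusEIA _⇒_ 𝟘)
    × (∀ x y → (EffectAlgebraNotions._≤E_ (PlusEIA _⇒_ 𝟘) x y → x ⇒ y ≡ one _⇒_ 𝟘)
             × (x ⇒ y ≡ one _⇒_ 𝟘 → EffectAlgebraNotions._≤E_ (PlusEIA _⇒_ 𝟘) x y))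
theorem5p4 _⇒_ 𝟘 isEIA = isEffectAlgebra , ascendingChainCondition , λ x y → ≤E⇒≤ , ≤⇒≤E
  where open InducedEffectAlgebra _⇒_ 𝟘 isEIA
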